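{- If $T$ is a ditree such that $\delta^-(T)\ge 1$, then $\rho^{\rm o}(T)=\gamma_t(T)$.
   Context: All digraphs are finite, and their arc relation is irreflexive (no loops); both arcs $uv$ and $vu$ may be present. For a digraph $D$ and vertex $v$, $N^+_D(v)$ is the set of out-neighbors of $v$ and $N^-_D(v)$ the set of in-neighbors. $\delta^-(D)$ is the minimum in-degree $\min_v|N^-_D(v)|$. The underlying graph of $D$ is the undirected graph on $V(D)$ in which $u,v$ are adjacent iff at least one of the arcs $uv$, $vu$ is in $D$; a ditree is a digraph whose underlying graph is a tree. If $\delta^-(D)\ge1$, a set $S$ is a total dominating set if $\bigcup_{v\in S}N^+_D(v)=V(D)$, and $\gamma_t(D)$ is the minimum size of a total dominating set. A set $B\subseteq V(D)$ is an open packing if $N^-_D(u)\cap N^-_D(v)=\emptyset$ for all distinct $u,v\in B$; $\rho^{\rm o}(D)$ is the maximum size of an open packing. -}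

module Defs where

open import Data.Nat using (ℕ; zero; suc; _≤_; _≥_)
open import Data.Fin using (Fin; zero; suc; inject₁; fromℕ)
open import Data.Fin.Subset using (Subset; _∈_; ∣_∣)
open import Data.Bool using (Bool; true; false; _∨_; T)
open import Data.Product using (Σ; ∃; _×_; _,_)
open import Relation.Binary.PropositionalEquality using (_≡_; _≢_)
open import Relation.Nullary using (¬_)
open import Function.Definitions using (Injective)

record Digraph (n : ℕ) : Set where
  field
    arc     : Fin n → Fin n → Bool
    irrefl  : ∀ v → arc v v ≡ false
open Digraph public

module _ {n : ℕ} (D : Digraph n) where

  Arc : Fin n → Fin n → Set
  Arc u v = T (arc D u v)

  UAdj : Fin n → Fin n → Set
  UAdj u v = T (arc D u v ∨ arc D v u)

  data Walk : Fin n → Fin n → Set where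
    here : ∀ {u} → Walk u u
    step : ∀ {u w v} → UAdj u w → Walk w v → Walk u v

  Connected : Set
  Connected = ∀ u v → Walk u v

  record Cycle : Set where
    field
      k      : ℕ
      len≥3  : k ≥ 2
      c      : Fin (suc k) → Fin n
      inj    : Injective _≡_ _≡_ c
      adj    : ∀ (i : Fin k) → UAdj (c (inject₁ i)) (c (suc i))
      close  : UAdj (c (fromℕ k)) (c zero)

  Acyclic : Set
  Acyclic = ¬ Cycle

  IsDitree : Set
  IsDitree = (1 ≤ n) × Connected × Acyclic

  MinInDeg≥1 : Set
  MinInDeg≥1 = ∀ v → ∃ λ u → Arc u v

  IsTDS : Subset n → Set
  IsTDS S = ∀ v → ∃ λ u → u ∈ S × Arc u v

  IsOpenPacking : Subset n → Set
  IsOpenPacking B = ∀ u v → u ∈ B → v ∈ B → u ≢ v →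
                    ∀ w → ¬ (Arc w u × Arc w v)

  IsγT : ℕ → Set
  IsγT k = (Σ (Subset n) λ S → IsTDS S × ∣ S ∣ ≡ k)
         × (∀ S → IsTDS S → k ≤ ∣ S ∣)

  Isρo : ℕ → Set
  Isρo k = (Σ (Subset n) λ B → IsOpenPacking B × ∣ B ∣ ≡ k)
         × (∀ B → IsOpenPacking B → ∣ B ∣ ≤ k)

-- ρ° ≤ γ_t holds in every digraph: sending each member of an open packing to one of
-- its in-neighbours in a total dominating set is injective.
-- For γ_t ≤ ρ°, dominate a set R of vertices by induction on |R|. Acyclicity yields a
-- pendant arc p → v, v ∈ R: no in-neighbour of v other than p has an out-neighbour in R
-- besides v (otherwise such arcs chain into an infinite non-backtracking walk, which
-- must close a cycle). Add p to the dominating set and v to the packing, and recurse on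
-- R minus the out-neighbours of p: pendancy keeps the packing open, and the dominating
-- set grows by at most one while the packing grows by exactly one.
module Submission where

open import Defs
open import Data.Nat using (ℕ; zero; suc; _+_; _≤_; _<_; z≤n; s≤s)
open import Data.Nat.Properties
  using (≤-antisym; ≤-refl; <-irrefl; m≤n⇒m≤1+n; n<1+n; +-suc; +-comm; +-identityʳ;
         +-cancelʳ-≡; +-monoˡ-<; m<1+n⇒m<n∨m≡n; m≤n⇒∃[o]m+o≡n; module ≤-Reasoning)
open import Data.Nat.Induction using (<-wellFounded)
open import Data.Fin using (Fin; zero; suc; toℕ; fromℕ<; _≟_)
open import Data.Fin.Properties
  using (any?; pigeonhole; toℕ-injective; toℕ<n; toℕ-fromℕ<; toℕ-inject₁; toℕ-fromℕ; 0≢1+n)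
  renaming (suc-injective to Fin-suc-injective)
open import Data.Fin.Subset
  using (Subset; inside; outside; _∈_; _∉_; _⊆_; _∪_; _∩_; ∁; ⁅_⁆; _-_; ⊥; ⊤; ∣_∣; Nonempty; Empty)
open import Data.Fin.Subset.Properties
  using (_∈?_; nonempty?; ∈⊤; ∉⊥; ⊥⊆; x∈⁅x⁆; x∈⁅y⁆⇒x≡y; ∪-identityʳ; p⊆p∪q; x∈p∪q⁺; x∈p∪q⁻;
         x∈p∩q⁺; x∈p∩q⁻; x∈∁p⇒x∉p; x∉p⇒x∈∁p; p⊂q⇒∣p∣<∣q∣; x∈p∧x≢y⇒x∈p-y; x∈p⇒∣p-x∣<∣p∣)
open import Data.Vec using (_∷_; []; here; there; tabulate)
open import Data.Vec.Properties using (lookup∘tabulate; []=⇒lookup; lookup⇒[]=)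
open import Data.Bool using (T; _∨_)
open import Data.Bool.Properties using (T-≡; T-∨)
open import Data.Product using (∃; ∃₂; _×_; _,_; proj₁; proj₂)
open import Data.Sum using (inj₁; inj₂)
open import Function using (_∘_; Equivalence)
open import Induction.WellFounded using (Acc; acc)
open import Relation.Binary.PropositionalEquality using (_≡_; _≢_; refl; sym; trans; cong; subst; subst₂)
open import Relation.Nullary using (¬_; Dec; yes; no; contradiction)
open import Relation.Nullary.Decidable using (_×-dec_; ¬?; T?; map′)

open Equivalence using (to; from)

∣p∪⁅x⁆∣≤1+∣p∣ : ∀ {n} (p : Subset n) x → ∣ p ∪ ⁅ x ⁆ ∣ ≤ suc ∣ p ∣
∣p∪⁅x⁆∣≤1+∣p∣ (outside ∷ p) zero    rewrite ∪-identityʳ p = ≤-refl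
∣p∪⁅x⁆∣≤1+∣p∣ (inside  ∷ p) zero    rewrite ∪-identityʳ p = m≤n⇒m≤1+n ≤-refl
∣p∪⁅x⁆∣≤1+∣p∣ (outside ∷ p) (suc x) = ∣p∪⁅x⁆∣≤1+∣p∣ p x
∣p∪⁅x⁆∣≤1+∣p∣ (inside  ∷ p) (suc x) = s≤s (∣p∪⁅x⁆∣≤1+∣p∣ p x)

x∉p⇒∣p∣<∣p∪⁅x⁆∣ : ∀ {n} {p : Subset n} {x} → x ∉ p → ∣ p ∣ < ∣ p ∪ ⁅ x ⁆ ∣
x∉p⇒∣p∣<∣p∪⁅x⁆∣ {x = x} x∉p = p⊂q⇒∣p∣<∣q∣ (p⊆p∪q _ , x , x∈p∪q⁺ (inj₂ (x∈⁅x⁆ x)) , x∉p)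

injectiveOn-∘suc : ∀ {m n s} {p : Subset m} {f : Fin (suc m) → Fin n} →
               (∀ {x y} → x ∈ s ∷ p → y ∈ s ∷ p → f x ≡ f y → x ≡ y) →
               (∀ {x y} → x ∈ p → y ∈ p → f (suc x) ≡ f (suc y) → x ≡ y)
injectiveOn-∘suc inj x∈p y∈p = Fin-suc-injective ∘ inj (there x∈p) (there y∈p)

injective⇒∣p∣≤∣q∣ : ∀ {m n} {p : Subset m} {q : Subset n} (f : Fin m → Fin n) →
                    (∀ {x} → x ∈ p → f x ∈ q) →
                    (∀ {x y} → x ∈ p → y ∈ p → f x ≡ f y → x ≡ y) → ∣ p ∣ ≤ ∣ q ∣
injective⇒∣p∣≤∣q∣ {p = []} f into inj = z≤n
injective⇒∣p∣≤∣q∣ {p = outside ∷ p} f into inj =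
  injective⇒∣p∣≤∣q∣ (f ∘ suc) (into ∘ there) (injectiveOn-∘suc inj)
injective⇒∣p∣≤∣q∣ {p = inside ∷ p} {q} f into inj = begin-strict
  ∣ p ∣          ≤⟨ injective⇒∣p∣≤∣q∣ (f ∘ suc) into′ (injectiveOn-∘suc inj) ⟩
  ∣ q - f zero ∣ <⟨ x∈p⇒∣p-x∣<∣p∣ (into here) ⟩
  ∣ q ∣          ∎
  where
  open ≤-Reasoning
  into′ : ∀ {x} → x ∈ p → f (suc x) ∈ q - f zero
  into′ x∈p = x∈p∧x≢y⇒x∈p-y (into (there x∈p)) λ e → 0≢1+n (inj here (there x∈p) (sym e))

InjectiveBelow : ∀ {n} → (ℕ → Fin n) → ℕ → Set
InjectiveBelow t j = ∀ {a b} → a < j → b < j → t a ≡ t b → a ≡ b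

record Repetition {n} (t : ℕ → Fin n) : Set where
  field
    start gap       : ℕ
    repeats         : t start ≡ t (suc gap + start)
    injectiveBefore : InjectiveBelow t (suc gap + start)

firstRepetition : ∀ {n} (t : ℕ → Fin n) → Repetition t
firstRepetition {n} t = search (suc n) 0 (+-identityʳ (suc n)) λ ()
  where
  extend : ∀ {j} → InjectiveBelow t j → (∀ (a : Fin j) → t (toℕ a) ≢ t j) → InjectiveBelow t (suc j)
  extend inj fresh a<1+j b<1+j e with m<1+n⇒m<n∨m≡n a<1+j | m<1+n⇒m<n∨m≡n b<1+j
  ... | inj₁ a<j  | inj₁ b<j  = inj a<j b<j e
  ... | inj₂ refl | inj₂ refl = refl
  ... | inj₂ refl | inj₁ b<j  =
    contradiction (trans (cong t (toℕ-fromℕ< b<j)) (sym e)) (fresh (fromℕ< b<j))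
  ... | inj₁ a<j  | inj₂ refl =
    contradiction (trans (cong t (toℕ-fromℕ< a<j)) e) (fresh (fromℕ< a<j))

  repetition : ∀ {j} (a : Fin j) → t (toℕ a) ≡ t j → InjectiveBelow t j → Repetition t
  repetition {j} a e inj with m≤n⇒∃[o]m+o≡n (toℕ<n a)
  ... | o , 1+a+o≡j = record
    { start = toℕ a ; gap = o
    ; repeats = subst (λ i → t (toℕ a) ≡ t i) (sym j≡) e
    ; injectiveBefore = subst (InjectiveBelow t) (sym j≡) inj }
    where
    j≡ : suc o + toℕ a ≡ j
    j≡ = trans (cong suc (+-comm o (toℕ a))) 1+a+o≡j

  -- k is fuel: once j = n + 1, t would be injective on more points than Fin n has.
  search : ∀ k j → k + j ≡ suc n → InjectiveBelow t j → Repetition t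
  search zero .(suc n) refl inj with pigeonhole (n<1+n n) (t ∘ toℕ)
  ... | a , b , a<b , e = contradiction a<b (<-irrefl (inj (toℕ<n a) (toℕ<n b) e))
  search (suc k) j eq inj with any? (λ (a : Fin j) → t (toℕ a) ≟ t j)
  ... | yes (a , e) = repetition a e inj
  ... | no fresh    =
    search k (suc j) (trans (+-suc k j) eq) (extend inj λ a e → fresh (a , e))

module _ {n} (D : Digraph n) where

  record NonBacktrackingWalk : Set where
    field
      vertex          : ℕ → Fin n
      adjacent        : ∀ i → UAdj D (vertex i) (vertex (suc i))
      nonBacktracking : ∀ i → vertex i ≢ vertex (suc (suc i))

  ¬UAdj-refl : ∀ u → ¬ UAdj D u u
  ¬UAdj-refl u = subst (λ b → T (b ∨ b)) (irrefl D u)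

  nonBacktrackingWalk⇒cycle : NonBacktrackingWalk → Cycle D
  nonBacktrackingWalk⇒cycle w = closeUp (firstRepetition vertex)
    where
    open NonBacktrackingWalk w
    closeUp : Repetition vertex → Cycle D
    closeUp record { start = i ; gap = zero ; repeats = e } =
      contradiction (subst (UAdj D (vertex i)) (sym e) (adjacent i)) (¬UAdj-refl (vertex i))
    closeUp record { start = i ; gap = suc zero ; repeats = e } = contradiction e (nonBacktracking i)
    closeUp record { start = i ; gap = suc (suc d) ; repeats = e ; injectiveBefore = inj } = record
      { k     = suc (suc d)
      ; len≥3 = s≤s (s≤s z≤n)
      ; c     = λ m → vertex (toℕ m + i)
      ; inj   = λ {m} {m′} e′ → toℕ-injective (+-cancelʳ-≡ i _ _
                  (inj (+-monoˡ-< i (toℕ<n m)) (+-monoˡ-< i (toℕ<n m′)) e′))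
      ; adj   = λ m → subst (λ a → UAdj D (vertex (a + i)) (vertex (suc (toℕ m + i))))
                  (sym (toℕ-inject₁ m)) (adjacent (toℕ m + i))
      ; close = subst₂ (λ a b → UAdj D (vertex (a + i)) b)
                  (sym (toℕ-fromℕ (suc (suc d)))) (sym e) (adjacent (suc (suc d) + i))
      }

  record ZigZag : Set where
    field
      tail head   : ℕ → Fin n
      forward     : ∀ k → Arc D (tail k) (head k)
      backward    : ∀ k → Arc D (tail (suc k)) (head k)
      tailsDiffer : ∀ k → tail (suc k) ≢ tail k
      headsDiffer : ∀ k → head (suc k) ≢ head k

  interleave : ∀ {A : Set} → (ℕ → A) → (ℕ → A) → ℕ → A
  interleave f g zero          = f 0
  interleave f g (suc zero)    = g 0
  interleave f g (suc (suc i)) = interleave (f ∘ suc) (g ∘ suc) i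

  zigZag⇒nonBacktrackingWalk : ZigZag → NonBacktrackingWalk
  zigZag⇒nonBacktrackingWalk z = record
    { vertex          = interleave (tail z) (head z)
    ; adjacent        = adjacent z
    ; nonBacktracking = nonBacktracking z
    }
    where
    open ZigZag
    shift : ZigZag → ZigZag
    shift z = record
      { tail = tail z ∘ suc ; head = head z ∘ suc
      ; forward = forward z ∘ suc ; backward = backward z ∘ suc
      ; tailsDiffer = tailsDiffer z ∘ suc ; headsDiffer = headsDiffer z ∘ suc }
    adjacent : ∀ z i → UAdj D (interleave (tail z) (head z) i) (interleave (tail z) (head z) (suc i))
    adjacent z zero          = from T-∨ (inj₁ (forward z 0))
    adjacent z (suc zero)    = from T-∨ (inj₂ (backward z 0))
    adjacent z (suc (suc i)) = adjacent (shift z) i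
    nonBacktracking : ∀ z i → interleave (tail z) (head z) i ≢ interleave (tail z) (head z) (suc (suc i))
    nonBacktracking z zero          = tailsDiffer z 0 ∘ sym
    nonBacktracking z (suc zero)    = headsDiffer z 0 ∘ sym
    nonBacktracking z (suc (suc i)) = nonBacktracking (shift z) i

  N⁺ : Fin n → Subset n
  N⁺ u = tabulate (arc D u)

  Arc⇒∈N⁺ : ∀ {u x} → Arc D u x → x ∈ N⁺ u
  Arc⇒∈N⁺ {u} {x} a = lookup⇒[]= x _ (trans (lookup∘tabulate (arc D u) x) (to T-≡ a))

  ∈N⁺⇒Arc : ∀ {u x} → x ∈ N⁺ u → Arc D u x
  ∈N⁺⇒Arc {u} {x} x∈N⁺u = from T-≡ (trans (sym (lookup∘tabulate (arc D u) x)) ([]=⇒lookup x∈N⁺u))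

  module _ (R : Subset n) where

    record PendantArc (p v : Fin n) : Set where
      field
        p→v  : Arc D p v
        v∈R  : v ∈ R
        otherInNeighbours : ∀ {w x} → Arc D w v → w ≢ p → x ∈ R → Arc D w x → x ≡ v

    record Escape (p v : Fin n) : Set where
      constructor escape
      field
        {w x} : Fin n
        w→v   : Arc D w v
        w≢p   : w ≢ p
        x∈R   : x ∈ R
        w→x   : Arc D w x
        x≢v   : x ≢ v

    escape? : ∀ p v → Dec (Escape p v)
    escape? p v = map′ (λ (_ , _ , w→v , w≢p , x∈R , w→x , x≢v) → escape w→v w≢p x∈R w→x x≢v)
                       (λ (escape w→v w≢p x∈R w→x x≢v) → _ , _ , w→v , w≢p , x∈R , w→x , x≢v)
      (any? λ w → any? λ x →
        T? (arc D w v) ×-dec ¬? (w ≟ p) ×-dec x ∈? R ×-dec T? (arc D w x) ×-dec ¬? (x ≟ v))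

    ¬escape⇒pendantArc : ∀ {p v} → Arc D p v → v ∈ R → ¬ Escape p v → PendantArc p v
    ¬escape⇒pendantArc {p} {v} p→v v∈R ¬escape = record
      { p→v = p→v ; v∈R = v∈R ; otherInNeighbours = other }
      where
      other : ∀ {w x} → Arc D w v → w ≢ p → x ∈ R → Arc D w x → x ≡ v
      other {w} {x} w→v w≢p x∈R w→x with x ≟ v
      ... | yes x≡v = x≡v
      ... | no x≢v  = contradiction (escape w→v w≢p x∈R w→x x≢v) ¬escape

    record ArcIntoR : Set where
      field
        {tail head} : Fin n
        tail→head   : Arc D tail head
        head∈R      : head ∈ R

    escaping⇒zigZag : MinInDeg≥1 D → Nonempty R →
                      (∀ {p v} → Arc D p v → v ∈ R → Escape p v) → ZigZag
    escaping⇒zigZag δ⁻≥1 (v₀ , v₀∈R) escaping = record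
      { tail        = ArcIntoR.tail ∘ arcs
      ; head        = ArcIntoR.head ∘ arcs
      ; forward     = ArcIntoR.tail→head ∘ arcs
      ; backward    = Escape.w→v ∘ escapeFrom ∘ arcs
      ; tailsDiffer = Escape.w≢p ∘ escapeFrom ∘ arcs
      ; headsDiffer = Escape.x≢v ∘ escapeFrom ∘ arcs
      }
      where
      escapeFrom : (a : ArcIntoR) → Escape (ArcIntoR.tail a) (ArcIntoR.head a)
      escapeFrom a = escaping (ArcIntoR.tail→head a) (ArcIntoR.head∈R a)
      arcs : ℕ → ArcIntoR
      arcs zero    = record { tail→head = proj₂ (δ⁻≥1 v₀) ; head∈R = v₀∈R }
      arcs (suc k) = record { tail→head = w→x ; head∈R = x∈R }
        where open Escape (escapeFrom (arcs k))

    pendantArc-exists : Acyclic D → MinInDeg≥1 D → Nonempty R → ∃₂ PendantArc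
    pendantArc-exists acyclic δ⁻≥1 nonempty
      with any? (λ p → any? λ v → T? (arc D p v) ×-dec v ∈? R ×-dec ¬? (escape? p v))
    ... | yes (p , v , p→v , v∈R , ¬escape) = p , v , ¬escape⇒pendantArc p→v v∈R ¬escape
    ... | no none = contradiction (nonBacktrackingWalk⇒cycle (zigZag⇒nonBacktrackingWalk
                      (escaping⇒zigZag δ⁻≥1 nonempty escaping))) acyclic
      where
      escaping : ∀ {p v} → Arc D p v → v ∈ R → Escape p v
      escaping {p} {v} p→v v∈R with escape? p v
      ... | yes e       = e
      ... | no ¬escape  = contradiction (p , v , p→v , v∈R , ¬escape) none

  _∖N⁺_ : Subset n → Fin n → Subset n
  R ∖N⁺ p = R ∩ ∁ (N⁺ p)

  ∈∖N⁺⁻ : ∀ {R p x} → x ∈ R ∖N⁺ p → x ∈ R × ¬ Arc D p x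
  ∈∖N⁺⁻ {R} {p} x∈ with x∈p∩q⁻ R _ x∈
  ... | x∈R , x∈∁N⁺p = x∈R , x∈∁p⇒x∉p x∈∁N⁺p ∘ Arc⇒∈N⁺

  ∈∖N⁺⁺ : ∀ {R p x} → x ∈ R → ¬ Arc D p x → x ∈ R ∖N⁺ p
  ∈∖N⁺⁺ x∈R ¬p→x = x∈p∩q⁺ (x∈R , x∉p⇒x∈∁p (¬p→x ∘ ∈N⁺⇒Arc))

  record DominationPacking (R : Subset n) : Set where
    field
      dominator packing     : Subset n
      dominates             : ∀ {v} → v ∈ R → ∃ λ u → u ∈ dominator × Arc D u v
      packing⊆R             : packing ⊆ R
      isOpenPacking         : IsOpenPacking D packing
      ∣dominator∣≤∣packing∣ : ∣ dominator ∣ ≤ ∣ packing ∣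

  emptyDominationPacking : ∀ {R} → Empty R → DominationPacking R
  emptyDominationPacking empty = record
    { dominator = ⊥ ; packing = ⊥
    ; dominates = λ {v} v∈R → contradiction (v , v∈R) empty
    ; packing⊆R = ⊥⊆
    ; isOpenPacking = λ u _ u∈⊥ → contradiction u∈⊥ ∉⊥
    ; ∣dominator∣≤∣packing∣ = ≤-refl }

  ∣R∖N⁺p∣<∣R∣ : ∀ {R p v} → PendantArc R p v → ∣ R ∖N⁺ p ∣ < ∣ R ∣
  ∣R∖N⁺p∣<∣R∣ {v = v} pendant =
    p⊂q⇒∣p∣<∣q∣ (proj₁ ∘ ∈∖N⁺⁻ , v , v∈R , λ v∈ → proj₂ (∈∖N⁺⁻ v∈) p→v)
    where open PendantArc pendant

  extendDominationPacking : ∀ {R p v} → PendantArc R p v →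
                            DominationPacking (R ∖N⁺ p) → DominationPacking R
  extendDominationPacking {R} {p} {v} pendant dp = record
    { dominator = dominator ∪ ⁅ p ⁆
    ; packing = packing ∪ ⁅ v ⁆
    ; dominates = dominates′
    ; packing⊆R = packing⊆R′
    ; isOpenPacking = isOpenPacking′
    ; ∣dominator∣≤∣packing∣ = begin
        ∣ dominator ∪ ⁅ p ⁆ ∣ ≤⟨ ∣p∪⁅x⁆∣≤1+∣p∣ dominator p ⟩
        suc ∣ dominator ∣     ≤⟨ s≤s ∣dominator∣≤∣packing∣ ⟩
        suc ∣ packing ∣       ≤⟨ x∉p⇒∣p∣<∣p∪⁅x⁆∣ v∉packing ⟩
        ∣ packing ∪ ⁅ v ⁆ ∣   ∎
    }
    where
    open PendantArc pendant
    open DominationPacking dp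
    open ≤-Reasoning

    v∉packing : v ∉ packing
    v∉packing v∈ = proj₂ (∈∖N⁺⁻ (packing⊆R v∈)) p→v

    dominates′ : ∀ {u} → u ∈ R → ∃ λ w → w ∈ dominator ∪ ⁅ p ⁆ × Arc D w u
    dominates′ {u} u∈R with T? (arc D p u)
    ... | yes p→u = p , x∈p∪q⁺ (inj₂ (x∈⁅x⁆ p)) , p→u
    ... | no ¬p→u with dominates (∈∖N⁺⁺ u∈R ¬p→u)
    ...   | w , w∈ , w→u = w , x∈p∪q⁺ (inj₁ w∈) , w→u

    packing⊆R′ : packing ∪ ⁅ v ⁆ ⊆ R
    packing⊆R′ b∈ with x∈p∪q⁻ packing _ b∈
    ... | inj₁ b∈packing = proj₁ (∈∖N⁺⁻ (packing⊆R b∈packing))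
    ... | inj₂ b∈⁅v⁆     = subst (_∈ R) (sym (x∈⁅y⁆⇒x≡y v b∈⁅v⁆)) v∈R

    noCommonInNeighbour : ∀ {b} → b ∈ packing → ∀ w → ¬ (Arc D w v × Arc D w b)
    noCommonInNeighbour {b} b∈ w (w→v , w→b) with w ≟ p | ∈∖N⁺⁻ (packing⊆R b∈)
    ... | yes refl | _ , ¬p→b = ¬p→b w→b
    ... | no w≢p   | b∈R , _  =
      v∉packing (subst (_∈ packing) (otherInNeighbours w→v w≢p b∈R w→b) b∈)

    isOpenPacking′ : IsOpenPacking D (packing ∪ ⁅ v ⁆)
    isOpenPacking′ a b a∈ b∈ a≢b w (w→a , w→b) with x∈p∪q⁻ packing _ a∈ | x∈p∪q⁻ packing _ b∈
    ... | inj₁ a∈′ | inj₁ b∈′ = isOpenPacking a b a∈′ b∈′ a≢b w (w→a , w→b)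
    ... | inj₁ a∈′ | inj₂ b∈⁅v⁆ with refl ← x∈⁅y⁆⇒x≡y v b∈⁅v⁆ = noCommonInNeighbour a∈′ w (w→b , w→a)
    ... | inj₂ a∈⁅v⁆ | inj₁ b∈′ with refl ← x∈⁅y⁆⇒x≡y v a∈⁅v⁆ = noCommonInNeighbour b∈′ w (w→a , w→b)
    ... | inj₂ a∈⁅v⁆ | inj₂ b∈⁅v⁆ = a≢b (trans (x∈⁅y⁆⇒x≡y v a∈⁅v⁆) (sym (x∈⁅y⁆⇒x≡y v b∈⁅v⁆)))

  dominationPacking : Acyclic D → MinInDeg≥1 D → ∀ R → DominationPacking R
  dominationPacking acyclic δ⁻≥1 R = go R (<-wellFounded ∣ R ∣)
    where
    go : ∀ R → Acc _<_ ∣ R ∣ → DominationPacking R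
    go R (acc rec) with nonempty? R
    ... | no empty = emptyDominationPacking empty
    ... | yes nonempty with pendantArc-exists R acyclic δ⁻≥1 nonempty
    ...   | p , v , pendant =
      extendDominationPacking pendant (go (R ∖N⁺ p) (rec (∣R∖N⁺p∣<∣R∣ pendant)))

  ∣openPacking∣≤∣totalDominatingSet∣ : ∀ {B S} → IsOpenPacking D B → IsTDS D S → ∣ B ∣ ≤ ∣ S ∣
  ∣openPacking∣≤∣totalDominatingSet∣ {B} packs dominates =
    injective⇒∣p∣≤∣q∣ dominatorOf (λ {b} _ → proj₁ (proj₂ (dominates b))) injective
    where
    dominatorOf : Fin n → Fin n
    dominatorOf = proj₁ ∘ dominates
    injective : ∀ {x y} → x ∈ B → y ∈ B → dominatorOf x ≡ dominatorOf y → x ≡ y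
    injective {x} {y} x∈B y∈B e with x ≟ y
    ... | yes x≡y = x≡y
    ... | no x≢y  = contradiction
      (proj₂ (proj₂ (dominates x)) , subst (λ u → Arc D u y) (sym e) (proj₂ (proj₂ (dominates y))))
      (packs x y x∈B y∈B x≢y (dominatorOf x))

theorem1p3 : ∀ {n : ℕ} (T : Digraph n) → IsDitree T → MinInDeg≥1 T →
    ∀ (p g : ℕ) → Isρo T p → IsγT T g → p ≡ g
theorem1p3 D (_ , _ , acyclic) δ⁻≥1 ρ γ
           ((B , packs , ∣B∣≡ρ) , maximal) ((S , isTDS , ∣S∣≡γ) , minimal) =
  ≤-antisym (subst₂ _≤_ ∣B∣≡ρ ∣S∣≡γ (∣openPacking∣≤∣totalDominatingSet∣ D packs isTDS)) γ≤ρ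
  where
  open DominationPacking (dominationPacking D acyclic δ⁻≥1 ⊤)
  open ≤-Reasoning
  γ≤ρ : γ ≤ ρ
  γ≤ρ = begin
    γ                 ≤⟨ minimal dominator (λ v → dominates ∈⊤) ⟩
    ∣ dominator ∣     ≤⟨ ∣dominator∣≤∣packing∣ ⟩
    ∣ packing ∣       ≤⟨ maximal packing isOpenPacking ⟩
    ρ                 ∎
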